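{- Let $Q$ be a quantale, $M,N,P$ left $Q$-modules, and $f: P\to M$, $g: P \to N$ injective $Q$-module homomorphisms. Let $\vartheta$ be the $Q$-module congruence on $M\times N$ (componentwise operations) generated by $\{((f(w),\bot_N),(\bot_M,g(w))) \mid w \in P\}$. Then for all $(u,v) \in M\times N$, $(u,v)$ is $\vartheta$-saturated if and only if $\{w \in P \mid f(w) \leq u\} = \{w \in P \mid g(w)\leq v\}$.
   Context: A (unital) quantale is a complete lattice with a monoid structure whose product distributes over arbitrary joins in each argument; a left $Q$-module is a complete lattice with an associative unital action of $Q$ distributing over arbitrary joins in both arguments; homomorphisms preserve arbitrary joins and the action. For a relation $R$ on a $Q$-module $X$, an element $s\in X$ is $R$-saturated if for all $(x,y)\in R$ and $a\in Q$: $ax\leq s \iff ay \leq s$. -}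

module Defs where

open import Level using (Level; 0ℓ)
open import Data.Empty using (⊥)
open import Data.Product using (_×_; _,_; proj₁; proj₂; Σ)
open import Function using (_∘_)
open import Function.Bundles using (_⇔_)
open import Relation.Binary.Core using (Rel)
open import Relation.Binary.Structures using (IsPartialOrder; IsEquivalence)
open import Relation.Binary.PropositionalEquality using (_≡_)

record CompleteLattice : Set₁ where
  field
    Carrier        : Set
    _≤_            : Carrier → Carrier → Set
    isPartialOrder : IsPartialOrder _≡_ _≤_
    ⋁              : {I : Set} → (I → Carrier) → Carrier
    ⋁-upper        : {I : Set} (x : I → Carrier) (i : I) → x i ≤ ⋁ x
    ⋁-least        : {I : Set} (x : I → Carrier) (z : Carrier) →
                     ((i : I) → x i ≤ z) → ⋁ x ≤ z

  ⊥ₗ : Carrier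
  ⊥ₗ = ⋁ {⊥} (λ ())

record Quantale : Set₁ where
  field
    lattice : CompleteLattice
  open CompleteLattice lattice public
  field
    _·_      : Carrier → Carrier → Carrier
    e        : Carrier
    ·-assoc  : ∀ a b c → (a · b) · c ≡ a · (b · c)
    ·-idˡ    : ∀ a → e · a ≡ a
    ·-idʳ    : ∀ a → a · e ≡ a
    ·-distˡ  : ∀ {I : Set} (a : Carrier) (x : I → Carrier) → a · ⋁ x ≡ ⋁ (λ i → a · x i)
    ·-distʳ  : ∀ {I : Set} (x : I → Carrier) (a : Carrier) → ⋁ x · a ≡ ⋁ (λ i → x i · a)

record Module (Q : Quantale) : Set₁ where
  module Q = Quantale Q
  field
    lattice : CompleteLattice
  open CompleteLattice lattice public
  field
    _∙_     : Q.Carrier → Carrier → Carrier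
    ∙-assoc : ∀ a b x → (a Q.· b) ∙ x ≡ a ∙ (b ∙ x)
    ∙-id    : ∀ x → Q.e ∙ x ≡ x
    ∙-distˡ : ∀ {I : Set} (a : Q.Carrier) (x : I → Carrier) → a ∙ ⋁ x ≡ ⋁ (λ i → a ∙ x i)
    ∙-distʳ : ∀ {I : Set} (a : I → Q.Carrier) (x : Carrier) → Q.⋁ a ∙ x ≡ ⋁ (λ i → a i ∙ x)

record Hom {Q : Quantale} (M N : Module Q) : Set₁ where
  private
    module M = Module M
    module N = Module N
  field
    fun      : M.Carrier → N.Carrier
    pres-⋁   : ∀ {I : Set} (x : I → M.Carrier) → fun (M.⋁ x) ≡ N.⋁ (λ i → fun (x i))
    pres-∙   : ∀ a x → fun (a M.∙ x) ≡ a N.∙ fun x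

module _ {Q : Quantale} where
  open import Relation.Binary.PropositionalEquality using (refl; cong₂; trans; sym)

  _⊗_ : Module Q → Module Q → Module Q
  M ⊗ N = record
    { lattice = lat
    ; _∙_ = λ a p → (a M.∙ proj₁ p , a N.∙ proj₂ p)
    ; ∙-assoc = λ a b p → cong₂ _,_ (M.∙-assoc a b (proj₁ p)) (N.∙-assoc a b (proj₂ p))
    ; ∙-id = λ p → cong₂ _,_ (M.∙-id (proj₁ p)) (N.∙-id (proj₂ p))
    ; ∙-distˡ = λ a x → cong₂ _,_ (M.∙-distˡ a (proj₁ ∘ x)) (N.∙-distˡ a (proj₂ ∘ x))
    ; ∙-distʳ = λ a p → cong₂ _,_ (M.∙-distʳ a (proj₁ p)) (N.∙-distʳ a (proj₂ p))
    }
    where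
    module M = Module M
    module N = Module N
    module MP = IsPartialOrder M.isPartialOrder
    module NP = IsPartialOrder N.isPartialOrder
    C = M.Carrier × N.Carrier
    _≤_ : C → C → Set
    p ≤ q = (proj₁ p M.≤ proj₁ q) × (proj₂ p N.≤ proj₂ q)
    po : IsPartialOrder _≡_ _≤_
    po = record
      { isPreorder = record
        { isEquivalence = record { refl = refl ; sym = sym ; trans = trans }
        ; reflexive = λ { refl → MP.refl , NP.refl }
        ; trans = λ { (a , b) (c , d) → MP.trans a c , NP.trans b d }
        }
      ; antisym = λ { (a , b) (c , d) → cong₂ _,_ (MP.antisym a c) (NP.antisym b d) }
      }
    lat : CompleteLattice
    lat = record
      { Carrier = C
      ; _≤_ = _≤_
      ; isPartialOrder = po
      ; ⋁ = λ x → (M.⋁ (proj₁ ∘ x) , N.⋁ (proj₂ ∘ x))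
      ; ⋁-upper = λ x i → M.⋁-upper (proj₁ ∘ x) i , N.⋁-upper (proj₂ ∘ x) i
      ; ⋁-least = λ x z h → M.⋁-least (proj₁ ∘ x) (proj₁ z) (proj₁ ∘ h)
                          , N.⋁-least (proj₂ ∘ x) (proj₂ z) (proj₂ ∘ h)
      }

module _ {Q : Quantale} (X : Module Q) where
  open Module X

  record IsCongruence (θ : Rel Carrier 0ℓ) : Set₁ where
    field
      isEquivalence : IsEquivalence θ
      compat-∙      : ∀ a {x y} → θ x y → θ (a ∙ x) (a ∙ y)
      compat-⋁      : ∀ {I : Set} (x y : I → Carrier) →
                      ((i : I) → θ (x i) (y i)) → θ (⋁ x) (⋁ y)

  GeneratedCongruence : {ℓ : Level} → Rel Carrier ℓ → Rel Carrier _
  GeneratedCongruence R x y =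
    (θ : Rel Carrier 0ℓ) → IsCongruence θ → (∀ a b → R a b → θ a b) → θ x y

  Saturated : {ℓ : Level} → Rel Carrier ℓ → Carrier → Set _
  Saturated R s = ∀ x y → R x y → (a : Q.Carrier) → ((a ∙ x) ≤ s) ⇔ ((a ∙ y) ≤ s)

-- For fixed s, the relation x ~ y :⇔ ∀ a → (a·x ≤ s ⇔ a·y ≤ s) is itself a module congruence,
-- and s is R-saturated exactly when R ⊆ ~; so saturation with respect to R and with respect to
-- the congruence generated by R coincide. For the generators ((f w , ⊥) , (⊥ , g w)), saturation
-- of (u , v) says a·f w ≤ u ⇔ a·g w ≤ v for all a, and since f and g commute with the action
-- this is the case a = e applied to all a·w.
module Submission where

open import Defs
open import Level using (0ℓ)
open import Data.Product using (_×_; _,_; Σ; proj₁; proj₂)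
open import Function.Bundles using (_⇔_; mk⇔; Equivalence)
open import Function.Definitions using (Injective)
open import Function.Properties.Equivalence using (⇔-setoid; ⇔-isEquivalence)
open import Relation.Binary.Core using (Rel)
open import Relation.Binary.Structures using (IsPartialOrder; IsEquivalence)
open import Relation.Binary.PropositionalEquality using (_≡_; refl; sym; cong; subst)
import Relation.Binary.Reasoning.Setoid as SetoidReasoning
open import Function.Related.Propositional using (Kind; module EquationalReasoning)

module ⇔-Reasoning {ℓ} = SetoidReasoning (⇔-setoid ℓ)
open module ⇔ {ℓ} = IsEquivalence (⇔-isEquivalence {ℓ}) using () renaming (refl to ⇔-refl)

Π-⇔ : ∀ {I : Set} {A B : I → Set} → (∀ i → A i ⇔ B i) → (∀ i → A i) ⇔ (∀ i → B i)
Π-⇔ A⇔B = mk⇔ (λ a i → Equivalence.to (A⇔B i) (a i)) (λ b i → Equivalence.from (A⇔B i) (b i))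

module CompleteLatticeProperties (L : CompleteLattice) where
  open CompleteLattice L
  open IsPartialOrder isPartialOrder using (trans)

  ⋁-≤⇔ : ∀ {I : Set} (x : I → Carrier) z → ⋁ x ≤ z ⇔ (∀ i → x i ≤ z)
  ⋁-≤⇔ x z = mk⇔ (λ ⋁x≤z i → trans (⋁-upper x i) ⋁x≤z) (⋁-least x z)

module ModuleProperties {Q : Quantale} (X : Module Q) where
  open Module X
  open CompleteLatticeProperties lattice public

  ∙-⊥ₗ-least : ∀ a z → (a ∙ ⊥ₗ) ≤ z
  ∙-⊥ₗ-least a z = subst (_≤ z) (sym (∙-distˡ a _)) (⋁-least _ z (λ ()))

  ∙-id-≤⇔ : ∀ x z → (Q.e ∙ x) ≤ z ⇔ x ≤ z
  ∙-id-≤⇔ x z rewrite ∙-id x = ⇔-refl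

module _ {Q : Quantale} (X : Module Q) where
  open Module X
  open ModuleProperties X

  SaturationKernel : Carrier → Rel Carrier 0ℓ
  SaturationKernel s x y = ∀ a → (a ∙ x) ≤ s ⇔ (a ∙ y) ≤ s

  saturationKernel-isCongruence : ∀ s → IsCongruence X (SaturationKernel s)
  saturationKernel-isCongruence s = record
    { isEquivalence = record
      { refl  = λ a → ⇔-refl
      ; sym   = λ x~y a → ⇔.sym (x~y a)
      ; trans = λ x~y y~z a → ⇔.trans (x~y a) (y~z a)
      }
    ; compat-∙ = compat-∙
    ; compat-⋁ = compat-⋁
    }
    where
    open ⇔-Reasoning

    compat-∙ : ∀ b {x y} → SaturationKernel s x y → SaturationKernel s (b ∙ x) (b ∙ y)
    compat-∙ b {x} {y} x~y a = begin
      (a ∙ (b ∙ x)) ≤ s      ≡⟨ cong (_≤ s) (∙-assoc a b x) ⟨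
      ((a Q.· b) ∙ x) ≤ s    ≈⟨ x~y (a Q.· b) ⟩
      ((a Q.· b) ∙ y) ≤ s    ≡⟨ cong (_≤ s) (∙-assoc a b y) ⟩
      (a ∙ (b ∙ y)) ≤ s      ∎

    compat-⋁ : ∀ {I : Set} (x y : I → Carrier) → (∀ i → SaturationKernel s (x i) (y i)) →
               SaturationKernel s (⋁ x) (⋁ y)
    compat-⋁ x y x~y a = begin
      (a ∙ ⋁ x) ≤ s            ≡⟨ cong (_≤ s) (∙-distˡ a x) ⟩
      ⋁ (λ i → a ∙ x i) ≤ s    ≈⟨ ⋁-≤⇔ _ s ⟩
      (∀ i → (a ∙ x i) ≤ s)    ≈⟨ Π-⇔ (λ i → x~y i a) ⟩
      (∀ i → (a ∙ y i) ≤ s)    ≈⟨ ⋁-≤⇔ _ s ⟨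
      ⋁ (λ i → a ∙ y i) ≤ s    ≡⟨ cong (_≤ s) (∙-distˡ a y) ⟨
      (a ∙ ⋁ y) ≤ s            ∎

  saturated-generatedCongruence⇔ : ∀ {ℓ} (R : Rel Carrier ℓ) s →
    Saturated X (GeneratedCongruence X R) s ⇔ Saturated X R s
  saturated-generatedCongruence⇔ R s = mk⇔
    (λ sat x y xRy → sat x y (λ θ _ R⊆θ → R⊆θ x y xRy))
    (λ sat x y x~y → x~y (SaturationKernel s) (saturationKernel-isCongruence s) sat)

module _ {Q : Quantale} {M N P : Module Q} (f : Hom P M) (g : Hom P N) where
  private
    module M = Module M
    module N = Module N
    module P = Module P
    module F = Hom f
    module G = Hom g
    open ModuleProperties M using () renaming (∙-⊥ₗ-least to ∙-⊥ₗ-leastᴹ; ∙-id-≤⇔ to ∙-id-≤⇔ᴹ)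
    open ModuleProperties N using () renaming (∙-⊥ₗ-least to ∙-⊥ₗ-leastᴺ; ∙-id-≤⇔ to ∙-id-≤⇔ᴺ)

  SpanRelation : Rel (Module.Carrier (M ⊗ N)) 0ℓ
  SpanRelation p q = Σ P.Carrier λ w → (p ≡ (F.fun w , N.⊥ₗ)) × (q ≡ (M.⊥ₗ , G.fun w))

  module _ (u : M.Carrier) (v : N.Carrier) where

    saturated-spanRelation⇔ :
      Saturated (M ⊗ N) SpanRelation (u , v) ⇔
      (∀ w → SaturationKernel (M ⊗ N) (u , v) (F.fun w , N.⊥ₗ) (M.⊥ₗ , G.fun w))
    saturated-spanRelation⇔ = mk⇔
      (λ sat w → sat _ _ (w , refl , refl))
      (λ sat → λ { _ _ (w , refl , refl) → sat w })

    saturationKernel-generator⇔ : ∀ w →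
      SaturationKernel (M ⊗ N) (u , v) (F.fun w , N.⊥ₗ) (M.⊥ₗ , G.fun w) ⇔
      (∀ a → (a M.∙ F.fun w) M.≤ u ⇔ (a N.∙ G.fun w) N.≤ v)
    saturationKernel-generator⇔ w = Π-⇔ λ a → drop-true-conjuncts (∙-⊥ₗ-leastᴺ a v) (∙-⊥ₗ-leastᴹ a u)
      where
      drop-true-conjuncts : ∀ {A B C D : Set} → C → D → ((A × C) ⇔ (D × B)) ⇔ (A ⇔ B)
      drop-true-conjuncts c d = mk⇔
        (λ A×C⇔D×B → mk⇔ (λ a → proj₂ (Equivalence.to A×C⇔D×B (a , c)))
                         (λ b → proj₁ (Equivalence.from A×C⇔D×B (d , b))))
        (λ A⇔B → mk⇔ (λ (a , _) → d , Equivalence.to A⇔B a)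
                     (λ (_ , b) → Equivalence.from A⇔B b , c))

    ∀-scalar⇔ :
      (∀ w a → (a M.∙ F.fun w) M.≤ u ⇔ (a N.∙ G.fun w) N.≤ v) ⇔
      (∀ w → F.fun w M.≤ u ⇔ G.fun w N.≤ v)
    ∀-scalar⇔ = mk⇔ at-unit at-scalar
      where
      open ⇔-Reasoning

      at-unit : (∀ w a → (a M.∙ F.fun w) M.≤ u ⇔ (a N.∙ G.fun w) N.≤ v) →
                (∀ w → F.fun w M.≤ u ⇔ G.fun w N.≤ v)
      at-unit H w = begin
        F.fun w M.≤ u              ≈⟨ ∙-id-≤⇔ᴹ (F.fun w) u ⟨
        (M.Q.e M.∙ F.fun w) M.≤ u  ≈⟨ H w M.Q.e ⟩
        (N.Q.e N.∙ G.fun w) N.≤ v  ≈⟨ ∙-id-≤⇔ᴺ (G.fun w) v ⟩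
        G.fun w N.≤ v              ∎

      at-scalar : (∀ w → F.fun w M.≤ u ⇔ G.fun w N.≤ v) →
                  (∀ w a → (a M.∙ F.fun w) M.≤ u ⇔ (a N.∙ G.fun w) N.≤ v)
      at-scalar H w a = begin
        (a M.∙ F.fun w) M.≤ u      ≡⟨ cong (M._≤ u) (F.pres-∙ a w) ⟨
        F.fun (a P.∙ w) M.≤ u      ≈⟨ H (a P.∙ w) ⟩
        G.fun (a P.∙ w) N.≤ v      ≡⟨ cong (N._≤ v) (G.pres-∙ a w) ⟩
        (a N.∙ G.fun w) N.≤ v      ∎

proposition4p4 : (Q : Quantale) (M N P : Module Q) (f : Hom P M) (g : Hom P N) →
    Injective _≡_ _≡_ (Hom.fun f) → Injective _≡_ _≡_ (Hom.fun g) →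
    (u : Module.Carrier M) (v : Module.Carrier N) →
    Saturated (M ⊗ N)
      (GeneratedCongruence (M ⊗ N)
        (λ p q → Σ (Module.Carrier P) (λ w →
          (p ≡ (Hom.fun f w , Module.⊥ₗ N)) × (q ≡ (Module.⊥ₗ M , Hom.fun g w)))))
      (u , v)
    ⇔ ((w : Module.Carrier P) → Module._≤_ M (Hom.fun f w) u ⇔ Module._≤_ N (Hom.fun g w) v)
proposition4p4 Q M N P f g _ _ u v = begin
  Saturated (M ⊗ N) (GeneratedCongruence (M ⊗ N) (SpanRelation f g)) (u , v)
    ∼⟨ saturated-generatedCongruence⇔ (M ⊗ N) (SpanRelation f g) (u , v) ⟩
  Saturated (M ⊗ N) (SpanRelation f g) (u , v)
    ∼⟨ saturated-spanRelation⇔ f g u v ⟩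
  (∀ w → SaturationKernel (M ⊗ N) (u , v) (Hom.fun f w , Module.⊥ₗ N) (Module.⊥ₗ M , Hom.fun g w))
    ∼⟨ Π-⇔ (saturationKernel-generator⇔ f g u v) ⟩
  (∀ w a → Module._≤_ M (Module._∙_ M a (Hom.fun f w)) u ⇔ Module._≤_ N (Module._∙_ N a (Hom.fun g w)) v)
    ∼⟨ ∀-scalar⇔ f g u v ⟩
  (∀ w → Module._≤_ M (Hom.fun f w) u ⇔ Module._≤_ N (Hom.fun g w) v)
    ∎
  where open EquationalReasoning {k = Kind.equivalence}
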